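{- Let $\tau$ be a triangular partition with diagonal $\partial=\partial_\tau$ and interior $\tau^\circ=\tau\setminus\partial$, and let $n>\ell(\tau)$ be an integer. For each cell $\gamma=(i,j)\in\partial$ define $$\alpha_\gamma=\{(x,y)\in\mathbb{N}^2 : (x,y+j+1)\in\tau\},\qquad \beta_\gamma=\{(x,y)\in\mathbb{N}^2 : (x+i+1,y)\in\tau\},$$ $$\alpha_\gamma^\partial=\{(x,y)\in\alpha_\gamma : (x,y+j+1)\in\partial\}.$$ Then $$\mathcal{E}_{(\tau,n)}(q;\mathbf{x})=q^{|\partial|}\,\mathcal{E}_{(\tau^\circ,n)}(q;\mathbf{x})+\sum_{\gamma=(i,j)\in\partial} q^{|\alpha_\gamma^\partial|}\,\mathcal{E}_{(\alpha_\gamma\setminus\alpha_\gamma^\partial,\ n-j-1)}(q;\mathbf{x})\,\mathcal{E}_{(\beta_\gamma,\ j+1)}(q;\mathbf{x}),$$ with $\mathcal{E}_{(\emptyset,m)}(q;\mathbf{x})=e_m(\mathbf{x})$.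
   Context: Partitions are identified with their diagrams: cells $(i,j)\in\mathbb{N}^2$ ($i$ column, $j$ row, starting at $0$); the north-east corner of cell $(i,j)$ is $(i+1,j+1)$; $\ell(\tau)$ is the number of nonzero parts of $\tau$. For positive reals $r,s$, $\tau_{rs}=\{(i,j)\in\mathbb{N}^2 : \frac{i+1}{r}+\frac{j+1}{s}\le 1\}$; a partition is triangular if it equals $\tau_{rs}$ for some positive reals $r,s$. A cell of a triangular partition is removable if removing it yields a triangular partition. The diagonal $\partial_\tau$ is the set of cells of $\tau$ whose north-east corners lie on the closed segment joining the north-east corners of its removable cells (a single cell if there is only one removable cell; empty if $\tau$ is empty). For a partition $\lambda$ with at most $m$ nonzero parts, padded with zeros to length $m$, $\lambda+1^m=(\lambda_1+1,\dots,\lambda_m+1)$, and $s_{(\lambda+1^m)/\lambda}(\mathbf{x})$ is the skew Schur function (a product of elementary symmetric functions $e_{c}$ over the column lengths $c$ of the skew shape). For a finite set $S\subseteq\mathbb{N}^2$ and integer $m\ge0$, $\mathcal{E}_{(S,m)}(q;\mathbf{x})=\sum_{\lambda} q^{|S|-|\lambda|}\, s_{(\lambda+1^m)/\lambda}(\mathbf{x})$, summed over partitions $\lambda$ with diagram contained in $S$ and at most $m$ nonzero parts (the symmetric function enumerator of height-$m$ $S$-parking functions); $e_m$ is the $m$-th elementary symmetric function.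
   Formalization: The parameters $r,s$ defining triangular partitions, and hence removable cells and the diagonal, range over the positive rationals rather than the positive reals. -}

module Defs where

open import Data.Nat as ℕ using (ℕ; zero; suc; _+_; _∸_; _<_)
open import Data.Nat.Properties using () renaming (_≟_ to _≟ℕ_)
open import Data.Integer using (+_)
open import Data.Rational as ℚ using (ℚ; Positive; _÷_; _/_; 0ℚ; 1ℚ)
open import Data.Rational.Properties using (pos⇒nonZero)
open import Data.Bool using (Bool; true; false; not; _∧_)
open import Data.List using (List; []; _∷_; _++_; map; concatMap; filter; length; upTo; foldr)
open import Data.List.Relation.Unary.Linked using (Linked)
open import Data.List.Relation.Unary.All using (All)
open import Data.List.Membership.Propositional using (_∈_)
import Data.List.Membership.DecPropositional as DecMem
open import Data.List.Relation.Unary.Unique.Propositional using (Unique)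
import Data.List.Relation.Binary.Permutation.Propositional as PermP
import Data.List.Relation.Binary.Permutation.Setoid as PermS
open import Data.Product using (Σ; _×_; _,_; ∃)
open import Data.Product.Properties using (≡-dec)
open import Data.Product.Relation.Binary.Pointwise.NonDependent using (×-setoid)
open import Relation.Binary.PropositionalEquality using (_≡_; setoid)
open import Relation.Binary.Definitions using (DecidableEquality)
open import Relation.Nullary.Decidable using (⌊_⌋; does)
open import Function.Bundles using (_⇔_)

-- A cell (i , j): i = column, j = row.
Cell : Set
Cell = ℕ × ℕ

_≟c_ : DecidableEquality Cell
_≟c_ = ≡-dec _≟ℕ_ _≟ℕ_

open DecMem _≟c_ using (_∈?_)

-- Finite subsets of ℕ² are represented by duplicate-free lists of cells
-- (only duplicate-free lists occur below); |S| = length S.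
CellSet : Set
CellSet = List Cell

infix 4 _∈ᵇ_
_∈ᵇ_ : Cell → CellSet → Bool
c ∈ᵇ S = does (c ∈? S)

-- Partition = list of its nonzero parts, weakly decreasing; the part
-- with index j is the length of row j.
IsPartition : List ℕ → Set
IsPartition τ = Linked ℕ._≥_ τ × All (0 <_) τ

ℓ : List ℕ → ℕ
ℓ = length

rowsFrom : ℕ → List ℕ → CellSet
rowsFrom r []       = []
rowsFrom r (a ∷ as) = map (λ i → (i , r)) (upTo a) ++ rowsFrom (suc r) as

cells : List ℕ → CellSet
cells = rowsFrom 0

box : ℕ → CellSet
box N = concatMap (λ y → map (λ x → (x , y)) (upTo N)) (upTo N)

ℕtoℚ : ℕ → ℚ
ℕtoℚ n = (+ n) / 1

InTau : (r s : ℚ) → .{{Positive r}} → .{{Positive s}} → Cell → Set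
InTau r s (i , j) =
  ((ℕtoℚ (suc i) ÷ r) {{pos⇒nonZero r}}) ℚ.+ ((ℕtoℚ (suc j) ÷ s) {{pos⇒nonZero s}}) ℚ.≤ 1ℚ

IsTriangularSet : CellSet → Set
IsTriangularSet S =
  Σ ℚ λ r → Σ ℚ λ s → Σ (Positive r) λ pr → Σ (Positive s) λ ps →
    ∀ (c : Cell) → (c ∈ S) ⇔ InTau r s {{pr}} {{ps}} c

IsTriangular : List ℕ → Set
IsTriangular τ = IsTriangularSet (cells τ)

remove : Cell → CellSet → CellSet
remove c = filter (λ d → Relation.Nullary.Decidable.¬? (d ≟c c))

Removable : List ℕ → Cell → Set
Removable τ c = c ∈ cells τ × IsTriangularSet (remove c (cells τ))

NE : Cell → ℚ × ℚ
NE (i , j) = (ℕtoℚ (suc i) , ℕtoℚ (suc j))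

OnSegment : ℚ × ℚ → ℚ × ℚ → ℚ × ℚ → Set
OnSegment (px , py) (ax , ay) (bx , by) =
  Σ ℚ λ t → (0ℚ ℚ.≤ t) × (t ℚ.≤ 1ℚ) ×
    (px ≡ ax ℚ.+ t ℚ.* (bx ℚ.- ax)) × (py ≡ ay ℚ.+ t ℚ.* (by ℚ.- ay))

-- c belongs to the diagonal ∂_τ: c ∈ τ and NE(c) lies on the closed segment
-- joining the NE corners of removable cells (γ₁ = γ₂ allowed, giving the
-- single-cell case; no removable cells gives the empty diagonal).
InDiagonal : List ℕ → Cell → Set
InDiagonal τ c =
  c ∈ cells τ ×
  ∃ λ γ₁ → ∃ λ γ₂ → Removable τ γ₁ × Removable τ γ₂ × OnSegment (NE c) (NE γ₁) (NE γ₂)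

IsDiagonal : List ℕ → CellSet → Set
IsDiagonal τ D = Unique D × (∀ c → (c ∈ D) ⇔ InDiagonal τ c)

-- Symmetric functions in q and x, written in the e-basis.
-- Λ[q] ≅ ℤ[q][e₁,e₂,…] (the eᵢ are algebraically independent); all
-- expressions here have coefficients in ℕ, so an element is a finite
-- multiset of monomials q^k e_{c₁}⋯e_{c_t}.  A monomial is (k , [c₁,…,c_t])
-- where the list of e-indices is a multiset (compared up to permutation).

Mono : Set
Mono = ℕ × List ℕ

SymQ : Set
SymQ = List Mono

module PermMono = PermS (×-setoid (setoid ℕ) (PermP.↭-setoid {A = ℕ}))

infix 4 _≈Sym_
_≈Sym_ : SymQ → SymQ → Set
_≈Sym_ = PermMono._↭_

infixl 6 _⊕_
_⊕_ : SymQ → SymQ → SymQ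
_⊕_ = _++_

infixl 7 _⊗_
_⊗_ : SymQ → SymQ → SymQ
P ⊗ Q = concatMap (λ { (k , es) → map (λ { (l , fs) → (k + l , es ++ fs) }) Q }) P

qpow· : ℕ → SymQ → SymQ
qpow· k = map (λ { (l , es) → (k + l , es) })

Σsym : {A : Set} → List A → (A → SymQ) → SymQ
Σsym xs f = concatMap f xs

-- e_m  (e_0 = 1 is the empty product)
eSym : ℕ → SymQ
eSym zero    = (0 , []) ∷ []
eSym (suc m) = (0 , suc m ∷ []) ∷ []

-- weakly decreasing lists of length m with entries ≤ N:
-- these are exactly the partitions with ≤ m nonzero parts and parts ≤ N,
-- padded with zeros to length m.
decSeqs : ℕ → ℕ → List (List ℕ)
decSeqs zero    N = [] ∷ []
decSeqs (suc m) N = concatMap (λ a → map (a ∷_) (decSeqs m a)) (upTo (suc N))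

count : ℕ → List ℕ → ℕ
count v []       = 0
count v (a ∷ as) with v ≟ℕ a
... | Relation.Nullary.Decidable.yes _ = suc (count v as)
... | Relation.Nullary.Decidable.no  _ = count v as

sumℕ : List ℕ → ℕ
sumℕ = foldr _+_ 0

-- the skew shape (λ+1^m)/λ for λ padded to length m: row r has the single
-- cell (λ_r , r).  Its column x has length #{r : λ_r = x}.
skewCells : List ℕ → CellSet
skewCells λ' = go 0 λ'
  where
  go : ℕ → List ℕ → CellSet
  go r []       = []
  go r (a ∷ as) = (a , r) ∷ go (suc r) as

columnLengths : List ℕ → List ℕ
columnLengths λ' =
  filter (λ c → Relation.Nullary.Decidable.¬? (c ≟ℕ 0))
    (map (λ x → length (filter (λ { (a , r) → x ≟ℕ a }) (skewCells λ')))
         (upTo (suc (sumℕ λ'))))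

-- s_{(λ+1^m)/λ} = ∏_{columns} e_{column length}
skewSchur : List ℕ → SymQ
skewSchur λ' = (0 , columnLengths λ') ∷ []

Contained : List ℕ → CellSet → Bool
Contained λ' S = allᵇ (cells λ')
  where
  allᵇ : CellSet → Bool
  allᵇ []       = true
  allᵇ (c ∷ cs) = (c ∈ᵇ S) ∧ allᵇ cs

-- partitions λ ⊆ S with at most m nonzero parts (padded to length m);
-- any such λ has parts ≤ |S|.
partsIn : CellSet → ℕ → List (List ℕ)
partsIn S m = filter (λ λ' → Relation.Nullary.Decidable.T? (Contained λ' S)) (decSeqs m (length S))

𝓔 : CellSet → ℕ → SymQ
𝓔 S m = Σsym (partsIn S m) (λ λ' → qpow· (length S ∸ sumℕ λ') (skewSchur λ'))

interior : List ℕ → CellSet → CellSet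
interior τ D = filter (λ c → Relation.Nullary.Decidable.¬? (c ∈? D)) (cells τ)

-- α_γ = {(x,y) : (x , y+j+1) ∈ τ}     (τ ⊆ box |τ|)
αset : List ℕ → Cell → CellSet
αset τ (i , j) = filter (λ { (x , y) → (x , y + suc j) ∈? cells τ }) (box (length (cells τ)))

α∂set : List ℕ → CellSet → Cell → CellSet
α∂set τ D (i , j) = filter (λ { (x , y) → (x , y + suc j) ∈? D }) (αset τ (i , j))

αminus : List ℕ → CellSet → Cell → CellSet
αminus τ D γ = filter (λ c → Relation.Nullary.Decidable.¬? (c ∈? α∂set τ D γ)) (αset τ γ)

βset : List ℕ → Cell → CellSet
βset τ (i , j) = filter (λ { (x , y) → (x + suc i , y) ∈? cells τ }) (box (length (cells τ)))

summand : List ℕ → ℕ → CellSet → Cell → SymQ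
summand τ n D (i , j) =
  qpow· (length (α∂set τ D (i , j)))
    (𝓔 (αminus τ D (i , j)) (n ∸ suc j) ⊗ 𝓔 (βset τ (i , j)) (suc j))

-- A cell of the diagonal of a triangular partition τ = τ_{rs} is a corner of τ.  The cell to
-- its right (resp. above it) has its north-east corner on the translate by (1,0) (resp. (0,1))
-- of the diagonal segment, whose endpoints are then the north-east corners of the right
-- (resp. upper) neighbours of removable cells.  Those neighbours lie outside τ, so the level
-- x/r + y/s exceeds 1 at both endpoints, hence along the whole segment by convexity.
--
-- The recursion then holds for every duplicate-free set D of corners of a partition τ.  A
-- partition λ ⊆ τ with n parts either avoids D, i.e. λ ⊆ τ°, or has a highest cell γ = (i,j)
-- in D.  Then the rows of λ above row j form μ ⊆ α_γ ∖ α_γ^∂ (by maximality of γ), the first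
-- j+1 rows with their first i+1 cells removed form ν ⊆ β_γ, and λ is ν + (i+1)^{j+1} followed
-- by μ.  Conversely every such pair glues back to some λ (the rows of μ are shorter than i+1
-- because γ is a corner), and distinct triples (γ, μ, ν) glue to distinct λ.  The corner splits
-- τ itself in the same way into β_γ and α_γ, so |τ| - |λ| = |α_γ^∂| + (|α_γ ∖ α_γ^∂| - |μ|)
-- + (|β_γ| - |ν|); and the columns of (λ+1^n)/λ are those of μ followed by those of ν.

module Submission where

open import Defs

module TriangularGeometry where

  open import Data.Nat as ℕ using (ℕ; suc)
  import Data.Nat.Properties as ℕ
  open import Data.Integer using (+_)
  open import Data.Rational as ℚ using (ℚ; mkℚ; 0ℚ; 1ℚ; _+_; _*_; _-_; _≤_; _<_; Positive; 1/_)
  open import Data.Rational.Properties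
  open import Data.Rational.Solver using (module +-*-Solver)
  open import Data.Nat.Coprimality using (1-coprimeTo; sym)
  open import Data.List.Membership.Propositional using (_∈_; _∉_)
  open import Data.List.Membership.Propositional.Properties using (∈-filter⁺; ∈-filter⁻)
  open import Data.Product using (_×_; _,_; proj₁; proj₂)
  open import Data.Sum using (inj₁; inj₂)
  open import Function using (Equivalence; _∘_)
  open import Relation.Nullary using (¬?)
  open import Relation.Binary.PropositionalEquality hiding (sym)
  import Relation.Binary.PropositionalEquality as ≡
  open +-*-Solver

  ℕtoℚ-suc : ∀ n → ℕtoℚ (suc n) ≡ ℕtoℚ n + 1ℚ
  ℕtoℚ-suc ℕ.zero  = refl
  ℕtoℚ-suc (suc n) rewrite ↥p/↧p≡p (mkℚ (+ suc n) 0 (sym (1-coprimeTo (suc n)))) =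
    cong ℕtoℚ (trans (ℕ.+-comm 1 (suc n)) (cong (ℕ._+ 1) (≡.sym (ℕ.*-identityʳ (suc n)))))

  infixl 6 _+ᵖ_
  _+ᵖ_ : ℚ × ℚ → ℚ × ℚ → ℚ × ℚ
  (x , y) +ᵖ (x′ , y′) = (x + x′ , y + y′)

  right up : Cell → Cell
  right (i , j) = (suc i , j)
  up    (i , j) = (i , suc j)

  NE-right : ∀ c → NE (right c) ≡ NE c +ᵖ (1ℚ , 0ℚ)
  NE-right (i , j) = cong₂ _,_ (ℕtoℚ-suc (suc i)) (≡.sym (+-identityʳ _))

  NE-up : ∀ c → NE (up c) ≡ NE c +ᵖ (0ℚ , 1ℚ)
  NE-up (i , j) = cong₂ _,_ (≡.sym (+-identityʳ _)) (ℕtoℚ-suc (suc j))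

  OnSegment-+ᵖ : ∀ {p a b} d → OnSegment p a b → OnSegment (p +ᵖ d) (a +ᵖ d) (b +ᵖ d)
  OnSegment-+ᵖ {_ , _} {ax , ay} {bx , by} (dx , dy) (t , 0≤t , t≤1 , refl , refl) =
    t , 0≤t , t≤1 , translate ax bx dx t , translate ay by dy t
    where
    translate : ∀ a b d t → a + t * (b - a) + d ≡ (a + d) + t * ((b + d) - (a + d))
    translate = solve 4 (λ a b d t → a :+ t :* (b :- a) :+ d := (a :+ d) :+ t :* ((b :+ d) :- (a :+ d))) refl

  0≤q-p : ∀ {p q} → p ≤ q → 0ℚ ≤ q - p
  0≤q-p {p} {q} p≤q = subst (_≤ q - p) (+-inverseʳ p) (+-monoˡ-≤ (ℚ.- p) p≤q)

  0≤p*q : ∀ {p q} → 0ℚ ≤ p → 0ℚ ≤ q → 0ℚ ≤ p * q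
  0≤p*q {p} {q} 0≤p 0≤q = subst (_≤ p * q) (*-zeroˡ q) (*-monoʳ-≤-nonNeg q {{ℚ.nonNegative 0≤q}} 0≤p)

  p≤p+q : ∀ {p q} → 0ℚ ≤ q → p ≤ p + q
  p≤p+q {p} 0≤q = subst (_≤ p + _) (+-identityʳ p) (+-monoʳ-≤ p 0≤q)

  convex-> : ∀ {c a b} t → c < a → c < b → 0ℚ ≤ t → t ≤ 1ℚ → c < a + t * (b - a)
  convex-> {c} {a} {b} t c<a c<b 0≤t t≤1 with ≤-total a b
  ... | inj₁ a≤b = <-≤-trans c<a (p≤p+q (0≤p*q 0≤t (0≤q-p a≤b)))
  ... | inj₂ b≤a = subst (c <_) from-b (<-≤-trans c<b (p≤p+q (0≤p*q (0≤q-p t≤1) (0≤q-p b≤a))))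
    where
    from-b : b + (1ℚ - t) * (a - b) ≡ a + t * (b - a)
    from-b = solve 3 (λ a b t → b :+ (con 1ℚ :- t) :* (a :- b) := a :+ t :* (b :- a)) refl a b t

  -- `InTau r s c` unfolds to `level (NE c) ≤ 1ℚ`, since `p ÷ r = p * 1/ r`.
  module Level (r s : ℚ) {{r>0 : Positive r}} {{s>0 : Positive s}} where

    u v : ℚ
    u = (1/ r) {{pos⇒nonZero r}}
    v = (1/ s) {{pos⇒nonZero s}}

    level : ℚ × ℚ → ℚ
    level (x , y) = x * u + y * v

    level-+ᵖ : ∀ p d → level (p +ᵖ d) ≡ level p + level d
    level-+ᵖ (x , y) (dx , dy) = solve 6 (λ x y dx dy u v →
      (x :+ dx) :* u :+ (y :+ dy) :* v := (x :* u :+ y :* v) :+ (dx :* u :+ dy :* v)) refl x y dx dy u v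

    level-mono : ∀ p {d} → 0ℚ ≤ proj₁ d → 0ℚ ≤ proj₂ d → level p ≤ level (p +ᵖ d)
    level-mono p {d} 0≤dx 0≤dy = subst (level p ≤_) (≡.sym (level-+ᵖ p d))
      (p≤p+q (+-mono-≤ (0≤p*q 0≤dx 0≤u) (0≤p*q 0≤dy 0≤v)))
      where
      0≤u = nonNegative⁻¹ u {{pos⇒nonNeg u {{1/pos⇒pos r}}}}
      0≤v = nonNegative⁻¹ v {{pos⇒nonNeg v {{1/pos⇒pos s}}}}

    level-convex : ∀ {c} {p a b} → OnSegment p a b → c < level a → c < level b → c < level p
    level-convex {c} {_ , _} {ax , ay} {bx , by} (t , 0≤t , t≤1 , refl , refl) c<a c<b =
      subst (c <_) (≡.sym (affine ax ay bx by t u v)) (convex-> t c<a c<b 0≤t t≤1)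
      where
      affine : ∀ ax ay bx by t u v →
        (ax + t * (bx - ax)) * u + (ay + t * (by - ay)) * v ≡ (ax * u + ay * v) + t * ((bx * u + by * v) - (ax * u + ay * v))
      affine = solve 7 (λ ax ay bx by t u v →
        (ax :+ t :* (bx :- ax)) :* u :+ (ay :+ t :* (by :- ay)) :* v
          := (ax :* u :+ ay :* v) :+ t :* ((bx :* u :+ by :* v) :- (ax :* u :+ ay :* v))) refl

  module _ (move : Cell → Cell) (d : ℚ × ℚ) (NE-move : ∀ c → NE (move c) ≡ NE c +ᵖ d)
           (0≤dx : 0ℚ ≤ proj₁ d) (0≤dy : 0ℚ ≤ proj₂ d) (move-≢ : ∀ c → move c ≢ c) where

    triangular-move⁻ : ∀ {S c} → IsTriangularSet S → move c ∈ S → c ∈ S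
    triangular-move⁻ {S} {c} (r , s , r>0 , s>0 , S⇔τrs) mc∈ =
      Equivalence.from (S⇔τrs c) (≤-trans (level-mono (NE c) 0≤dx 0≤dy) moved≤1)
      where
      open Level r s {{r>0}} {{s>0}}
      moved≤1 : level (NE c +ᵖ d) ≤ 1ℚ
      moved≤1 = subst (λ p → level p ≤ 1ℚ) (NE-move c) (Equivalence.to (S⇔τrs (move c)) mc∈)

    removable⇒move∉ : ∀ {τ γ} → Removable τ γ → move γ ∉ cells τ
    removable⇒move∉ {τ} {γ} (_ , τ∖γ-triangular) mγ∈ =
      proj₂ (∈-filter⁻ (λ c → ¬? (c ≟c γ)) {xs = cells τ}
        (triangular-move⁻ τ∖γ-triangular (∈-filter⁺ (λ c → ¬? (c ≟c γ)) mγ∈ (move-≢ γ)))) refl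

    diagonal⇒move∉ : ∀ {τ c} → IsTriangular τ → InDiagonal τ c → move c ∉ cells τ
    diagonal⇒move∉ {τ} {c} (r , s , r>0 , s>0 , τ⇔τrs) (_ , γ₁ , γ₂ , γ₁-removable , γ₂-removable , on) mc∈ =
      <-irrefl refl (<-≤-trans outside (Equivalence.to (τ⇔τrs (move c)) mc∈))
      where
      open Level r s {{r>0}} {{s>0}}
      moved-on : OnSegment (NE (move c)) (NE (move γ₁)) (NE (move γ₂))
      moved-on = subst (λ p → OnSegment p (NE (move γ₁)) (NE (move γ₂))) (≡.sym (NE-move c))
        (subst₂ (OnSegment (NE c +ᵖ d)) (≡.sym (NE-move γ₁)) (≡.sym (NE-move γ₂))
          (OnSegment-+ᵖ {NE c} {NE γ₁} {NE γ₂} d on))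
      beyond : ∀ {γ} → Removable τ γ → 1ℚ < level (NE (move γ))
      beyond {γ} γ-removable = ≰⇒> (removable⇒move∉ {τ} γ-removable ∘ Equivalence.from (τ⇔τrs (move γ)))
      outside : 1ℚ < level (NE (move c))
      outside = level-convex {p = NE (move c)} {NE (move γ₁)} {NE (move γ₂)} moved-on
                  (beyond γ₁-removable) (beyond γ₂-removable)

  0≤1 : 0ℚ ≤ 1ℚ
  0≤1 = nonNegative⁻¹ 1ℚ

  diagonal-right∉ : ∀ {τ c} → IsTriangular τ → InDiagonal τ c → right c ∉ cells τ
  diagonal-right∉ {τ} = diagonal⇒move∉ right (1ℚ , 0ℚ) NE-right 0≤1 ≤-refl (λ _ → ℕ.1+n≢n ∘ cong proj₁) {τ}

  diagonal-up∉ : ∀ {τ c} → IsTriangular τ → InDiagonal τ c → up c ∉ cells τ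
  diagonal-up∉ {τ} = diagonal⇒move∉ up (0ℚ , 1ℚ) NE-up ≤-refl 0≤1 (λ _ → ℕ.1+n≢n ∘ cong proj₂) {τ}

open TriangularGeometry using (right; up; diagonal-right∉; diagonal-up∉)

open import Data.Nat using (ℕ; zero; suc; _+_; _*_; _∸_; _≤_; _<_; _≥_; z≤n; s≤s; s≤s⁻¹; _≤?_; _<?_; _≟_)
open import Data.Nat.Properties
open import Data.Nat.ListAction.Properties using (sum-++)
open import Data.Nat.Solver using (module +-*-Solver)
open import Data.Bool using (Bool; true; false; T)
open import Data.Bool.Properties using (T-∧)
open import Data.List using (List; []; _∷_; [_]; _++_; map; concatMap; filter; length; upTo; applyUpTo; take; drop; cartesianProductWith)
import Data.List.Properties as List
open import Data.List.Relation.Unary.Any using (Any; here; there; any?)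
open import Data.List.Relation.Unary.All as All using (All; []; _∷_)
import Data.List.Relation.Unary.All.Properties as All
open import Data.List.Relation.Unary.AllPairs using ([]; _∷_)
open import Data.List.Relation.Unary.Linked using (Linked; []; [-]; _∷_)
open import Data.List.Relation.Unary.Unique.Propositional using (Unique)
import Data.List.Relation.Unary.Unique.Propositional.Properties as Unique
open import Data.List.Relation.Binary.Subset.Propositional using (_⊆_)
open import Data.List.Relation.Binary.Permutation.Propositional using (_↭_; ↭-sym; ↭⇒↭ₛ′; ↭-setoid)
import Data.List.Relation.Binary.Permutation.Propositional.Properties as ↭
open import Data.List.Relation.Binary.BagAndSetEquality using (∼bag⇒↭)
open import Data.List.Membership.Propositional using (_∈_; _∉_; find; lose)
open import Data.List.Membership.Propositional.Properties
open import Data.List.Membership.Propositional.Properties.WithK using (unique∧set⇒bag)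
import Data.List.Membership.DecPropositional as DecMembership
open import Data.Product using (∃; ∃₂; _×_; _,_; proj₁; proj₂)
open import Data.Product.Relation.Binary.Pointwise.NonDependent using (×-setoid)
open import Data.Sum using (_⊎_; inj₁; inj₂)
open import Data.Empty using (⊥-elim)
open import Function using (_∘_; id; _⇔_; mk⇔; Equivalence)
open import Relation.Nullary using (¬_; yes; no; does; ¬?; contradiction)
open import Relation.Nullary.Decidable using (T?)
open import Relation.Unary using (Pred; Decidable)
open import Relation.Unary.Properties using (∁?)
open import Relation.Binary.Bundles using (Setoid)
open import Relation.Binary.Definitions using (DecidableEquality)
open import Relation.Binary.PropositionalEquality hiding ([_])
import Relation.Binary.Reasoning.Setoid as SetoidReasoning

private variable
  A B : Set

unique∧sameMembers⇒↭ : {xs ys : List A} → Unique xs → Unique ys → (∀ {z} → z ∈ xs ⇔ z ∈ ys) → xs ↭ ys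
unique∧sameMembers⇒↭ xs! ys! same = ∼bag⇒↭ (unique∧set⇒bag xs! ys! same)

map-unique : {f : A → B} {xs : List A} → (∀ {x y} → x ∈ xs → y ∈ xs → f x ≡ f y → x ≡ y) →
             Unique xs → Unique (map f xs)
map-unique inj [] = []
map-unique inj (x∉ ∷ xs!) =
  All.map⁺ (All.tabulate λ y∈ fx≡fy → All.lookup x∉ y∈ (inj (here refl) (there y∈) fx≡fy))
  ∷ map-unique (λ p q → inj (there p) (there q)) xs!

map-↭-bijectiveOn : (f : A → B) {xs : List A} {ws : List B} → Unique xs → Unique ws →
  (∀ {x y} → x ∈ xs → y ∈ xs → f x ≡ f y → x ≡ y) →
  (∀ {x} → x ∈ xs → f x ∈ ws) → (∀ {w} → w ∈ ws → ∃ λ x → x ∈ xs × f x ≡ w) →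
  map f xs ↭ ws
map-↭-bijectiveOn f {xs} {ws} xs! ws! inj into onto =
  unique∧sameMembers⇒↭ (map-unique inj xs!) ws! (mk⇔ to from)
  where
  to : ∀ {w} → w ∈ map f xs → w ∈ ws
  to w∈ with _ , x∈ , refl ← ∈-map⁻ f w∈ = into x∈
  from : ∀ {w} → w ∈ ws → w ∈ map f xs
  from w∈ with _ , x∈ , refl ← onto w∈ = ∈-map⁺ f x∈

length-filter+∁ : ∀ {p} {P : Pred A p} (P? : Decidable P) (xs : List A) →
                  length (filter P? xs) + length (filter (∁? P?) xs) ≡ length xs
length-filter+∁ P? [] = refl
length-filter+∁ P? (x ∷ xs) with does (P? x)
... | true  = cong suc (length-filter+∁ P? xs)
... | false = trans (+-suc _ _) (cong suc (length-filter+∁ P? xs))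

concatMap-unique : (key : B → A) {f : A → List B} {xs : List A} → Unique xs →
  (∀ x → Unique (f x)) → (∀ {x b} → b ∈ f x → key b ≡ x) → Unique (concatMap f xs)
concatMap-unique key {f} {[]} [] f! keyed = []
concatMap-unique key {f} {x ∷ xs} (x∉ ∷ xs!) f! keyed =
  Unique.++⁺ (f! x) (concatMap-unique key xs! f! keyed) disjoint
  where
  disjoint : ∀ {b} → ¬ (b ∈ f x × b ∈ concatMap f xs)
  disjoint (b∈ , b∈′) with _ , x′∈ , b∈f′ ← find (∈-concatMap⁻ f {xs = xs} b∈′) =
    All.lookup x∉ x′∈ (trans (sym (keyed b∈)) (keyed b∈f′))

module _ (_≟ₐ_ : DecidableEquality A) where

  open DecMembership _≟ₐ_ using (_∈?_)

  filter-∈-↭ : {xs ys : List A} → Unique xs → Unique ys → ys ⊆ xs → filter (_∈? ys) xs ↭ ys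
  filter-∈-↭ {xs} {ys} xs! ys! ys⊆xs = unique∧sameMembers⇒↭ (Unique.filter⁺ (_∈? ys) xs!) ys!
    (mk⇔ (proj₂ ∘ ∈-filter⁻ (_∈? ys) {xs = xs}) (λ z∈ → ∈-filter⁺ (_∈? ys) (ys⊆xs z∈) z∈))

  length-mono-⊆ : {xs ys : List A} → Unique xs → Unique ys → xs ⊆ ys → length xs ≤ length ys
  length-mono-⊆ {xs} {ys} xs! ys! xs⊆ys = begin
    length xs                   ≡⟨ ↭.↭-length (filter-∈-↭ ys! xs! xs⊆ys) ⟨
    length (filter (_∈? xs) ys) ≤⟨ List.length-filter (_∈? xs) ys ⟩
    length ys                   ∎
    where open ≤-Reasoning

  length-⊆+filter-∉ : {xs ys : List A} → Unique xs → Unique ys → ys ⊆ xs →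
                      length ys + length (filter (λ z → ¬? (z ∈? ys)) xs) ≡ length xs
  length-⊆+filter-∉ {xs} {ys} xs! ys! ys⊆xs = begin
    length ys + length (filter (∁? (_∈? ys)) xs)
      ≡⟨ cong (_+ length (filter (∁? (_∈? ys)) xs)) (↭.↭-length (filter-∈-↭ xs! ys! ys⊆xs)) ⟨
    length (filter (_∈? ys) xs) + length (filter (∁? (_∈? ys)) xs)
      ≡⟨ length-filter+∁ (_∈? ys) xs ⟩
    length xs ∎
    where open ≡-Reasoning

maximal-satisfying : ∀ {p} (f : A → ℕ) {P : Pred A p} → Decidable P → {xs : List A} → Any P xs →
  ∃ λ a → a ∈ xs × P a × (∀ {b} → b ∈ xs → P b → f b ≤ f a)
maximal-satisfying f P? {x ∷ xs} any-x∷xs with any? P? xs | any-x∷xs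
... | no ¬any | here px =
  x , here refl , px , λ { (here refl) _ → ≤-refl ; (there b∈) pb → ⊥-elim (¬any (lose b∈ pb)) }
... | no ¬any | there any = ⊥-elim (¬any any)
... | yes any | _ with maximal-satisfying f P? any | P? x
...   | a , a∈ , pa , max | no ¬px = a , there a∈ , pa , λ { (here refl) px → ⊥-elim (¬px px) ; (there b∈) → max b∈ }
...   | a , a∈ , pa , max | yes px with f x ≤? f a
...     | yes fx≤fa = a , there a∈ , pa , λ { (here refl) _ → fx≤fa ; (there b∈) → max b∈ }
...     | no fx≰fa =
  x , here refl , px , λ { (here refl) _ → ≤-refl ; (there b∈) pb → ≤-trans (max b∈ pb) (<⇒≤ (≰⇒> fx≰fa)) }

part : List ℕ → ℕ → ℕ
part []       _       = 0
part (a ∷ _)  zero    = a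
part (_ ∷ as) (suc y) = part as y

part≤sum : ∀ as y → part as y ≤ sumℕ as
part≤sum []       y       = z≤n
part≤sum (a ∷ as) zero    = m≤m+n a (sumℕ as)
part≤sum (a ∷ as) (suc y) = ≤-trans (part≤sum as y) (m≤n+m (sumℕ as) a)

part>0⇒<length : ∀ as y → 0 < part as y → y < length as
part>0⇒<length (a ∷ as) zero    _   = s≤s z≤n
part>0⇒<length (a ∷ as) (suc y) a>0 = s≤s (part>0⇒<length as y a>0)

length≤sum : ∀ {as} → All (0 <_) as → length as ≤ sumℕ as
length≤sum []           = z≤n
length≤sum (a>0 ∷ as>0) = +-mono-≤ a>0 (length≤sum as>0)

Decreasing : List ℕ → Set
Decreasing λ' = ∀ y → part λ' (suc y) ≤ part λ' y

∷-decreasing : ∀ {a λ'} → part λ' 0 ≤ a → Decreasing λ' → Decreasing (a ∷ λ')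
∷-decreasing head≤a dec zero    = head≤a
∷-decreasing head≤a dec (suc y) = dec y

decreasing-antitone : ∀ {λ'} → Decreasing λ' → ∀ {y y′} → y ≤ y′ → part λ' y′ ≤ part λ' y
decreasing-antitone {λ'} dec {y} y≤y′ with _ , refl ← m≤n⇒∃[o]m+o≡n y≤y′ = go _
  where
  go : ∀ o → part λ' (y + o) ≤ part λ' y
  go zero    = ≤-reflexive (cong (part λ') (+-identityʳ y))
  go (suc o) = ≤-trans (≤-reflexive (cong (part λ') (+-suc y o))) (≤-trans (dec (y + o)) (go o))

linked⇒decreasing : ∀ {as} → Linked _≥_ as → Decreasing as
linked⇒decreasing []               _       = z≤n
linked⇒decreasing [-]              _       = z≤n
linked⇒decreasing (a≥b ∷ _)        zero    = a≥b
linked⇒decreasing (_ ∷ b∷as-linked) (suc y) = linked⇒decreasing b∷as-linked y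

∈-row⁻ : ∀ {r a x y : ℕ} → (x , y) ∈ map (λ i → (i , r)) (upTo a) → y ≡ r × x < a
∈-row⁻ {r} p with _ , i∈ , refl ← ∈-map⁻ (λ i → (i , r)) p = refl , ∈-upTo⁻ i∈

∈-rowsFrom⁻ : ∀ r as {x y} → (x , y) ∈ rowsFrom r as → ∃ λ k → y ≡ r + k × x < part as k
∈-rowsFrom⁻ r (a ∷ as) p with ∈-++⁻ (map (λ i → (i , r)) (upTo a)) p
... | inj₁ p′ with refl , x<a ← ∈-row⁻ p′ = 0 , sym (+-identityʳ r) , x<a
... | inj₂ p′ with k , refl , x< ← ∈-rowsFrom⁻ (suc r) as p′ = suc k , sym (+-suc r k) , x<

∈-rowsFrom⁺ : ∀ r as {x} k → x < part as k → (x , r + k) ∈ rowsFrom r as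
∈-rowsFrom⁺ r (a ∷ as) zero x<a rewrite +-identityʳ r =
  ∈-++⁺ˡ (∈-map⁺ (λ i → (i , r)) (∈-upTo⁺ x<a))
∈-rowsFrom⁺ r (a ∷ as) (suc k) x< rewrite +-suc r k =
  ∈-++⁺ʳ (map (λ i → (i , r)) (upTo a)) (∈-rowsFrom⁺ (suc r) as k x<)

∈-cells⁻ : ∀ as {x y} → (x , y) ∈ cells as → x < part as y
∈-cells⁻ as p with _ , refl , x< ← ∈-rowsFrom⁻ 0 as p = x<

∈-cells⁺ : ∀ as {x y} → x < part as y → (x , y) ∈ cells as
∈-cells⁺ as {y = y} = ∈-rowsFrom⁺ 0 as y

rowsFrom-unique : ∀ r as → Unique (rowsFrom r as)
rowsFrom-unique r []       = []
rowsFrom-unique r (a ∷ as) =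
  Unique.++⁺ (Unique.map⁺ (cong proj₁) (Unique.upTo⁺ a)) (rowsFrom-unique (suc r) as) disjoint
  where
  disjoint : ∀ {c} → ¬ (c ∈ map (λ i → (i , r)) (upTo a) × c ∈ rowsFrom (suc r) as)
  disjoint (p , q) with refl , _ ← ∈-row⁻ p | _ , r≡ , _ ← ∈-rowsFrom⁻ (suc r) as q = m≢1+m+n r r≡

cells-unique : ∀ as → Unique (cells as)
cells-unique = rowsFrom-unique 0

length-rowsFrom : ∀ r as → length (rowsFrom r as) ≡ sumℕ as
length-rowsFrom r []       = refl
length-rowsFrom r (a ∷ as) = begin
  length (row ++ rowsFrom (suc r) as)          ≡⟨ List.length-++ row ⟩
  length row + length (rowsFrom (suc r) as)    ≡⟨ cong₂ _+_ (trans (List.length-map _ (upTo a)) (List.length-upTo a))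
                                                            (length-rowsFrom (suc r) as) ⟩
  a + sumℕ as                                  ∎
  where
  open ≡-Reasoning
  row = map (λ i → (i , r)) (upTo a)

length-cells : ∀ as → length (cells as) ≡ sumℕ as
length-cells = length-rowsFrom 0

∈-box⁺ : ∀ {N x y : ℕ} → x < N → y < N → (x , y) ∈ box N
∈-box⁺ {N} {x} {y} x<N y<N = ∈-concatMap⁺ (λ y → map (λ x → (x , y)) (upTo N)) {xs = upTo N}
  (lose (∈-upTo⁺ y<N) (∈-map⁺ (λ x → (x , y)) (∈-upTo⁺ x<N)))

box-unique : ∀ N → Unique (box N)
box-unique N = concatMap-unique proj₂ (Unique.upTo⁺ N) (λ _ → Unique.map⁺ (cong proj₁) (Unique.upTo⁺ N)) keyed
  where
  keyed : ∀ {y c} → c ∈ map (λ x → (x , y)) (upTo N) → proj₂ c ≡ y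
  keyed {y} c∈ with _ , _ , refl ← ∈-map⁻ (λ x → (x , y)) c∈ = refl

cells-bounded : ∀ {τ x y} → IsPartition τ → (x , y) ∈ cells τ → x < length (cells τ) × y < length (cells τ)
cells-bounded {τ} {x} {y} (_ , τ>0) c∈ =
  ≤-trans x< (≤-trans (part≤sum τ y) sum≤N) ,
  ≤-trans (part>0⇒<length τ y (≤-trans (s≤s z≤n) x<)) (≤-trans (length≤sum τ>0) sum≤N)
  where
  x< = ∈-cells⁻ τ c∈
  sum≤N = ≤-reflexive (sym (length-cells τ))

open DecMembership _≟c_ using (_∈?_)

infix 4 _⊆ᴰ_
_⊆ᴰ_ : List ℕ → CellSet → Set
λ' ⊆ᴰ S = ∀ {x y} → x < part λ' y → (x , y) ∈ S

-- `Contained` recurses through an unnamed `where` function; unification solves this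
-- meta to that function, which gives it a name to reason about.
mutual
  containedᵇ : List ℕ → CellSet → CellSet → Bool
  containedᵇ λ' S = _

  containedᵇ-cells : ∀ λ' S → containedᵇ λ' S (cells λ') ≡ Contained λ' S
  containedᵇ-cells λ' S with cells λ'
  ... | _ = refl

T-∈ᵇ⇔ : ∀ {c S} → T (c ∈ᵇ S) ⇔ c ∈ S
T-∈ᵇ⇔ {c} {S} with c ∈? S
... | yes c∈ = mk⇔ (λ _ → c∈) _
... | no  c∉ = mk⇔ (λ ()) c∉

T-containedᵇ⇔ : ∀ λ' S cs → T (containedᵇ λ' S cs) ⇔ (cs ⊆ S)
T-containedᵇ⇔ λ' S []       = mk⇔ (λ _ ()) _
T-containedᵇ⇔ λ' S (c ∷ cs) = mk⇔ head∷tail⊆ (λ c∷cs⊆S → Equivalence.from T-∧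
  (Equivalence.from T-∈ᵇ⇔ (c∷cs⊆S (here refl)) , Equivalence.from (T-containedᵇ⇔ λ' S cs) (c∷cs⊆S ∘ there)))
  where
  head∷tail⊆ : T (containedᵇ λ' S (c ∷ cs)) → c ∷ cs ⊆ S
  head∷tail⊆ t (here refl) = Equivalence.to T-∈ᵇ⇔ (proj₁ (Equivalence.to T-∧ t))
  head∷tail⊆ t (there d∈)  = Equivalence.to (T-containedᵇ⇔ λ' S cs) (proj₂ (Equivalence.to T-∧ t)) d∈

T-Contained⇔ : ∀ λ' S → T (Contained λ' S) ⇔ λ' ⊆ᴰ S
T-Contained⇔ λ' S = mk⇔ ⊆ᴰ-of-T T-of-⊆ᴰ
  where
  open Equivalence (T-containedᵇ⇔ λ' S (cells λ'))
  ⊆ᴰ-of-T : T (Contained λ' S) → λ' ⊆ᴰ S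
  ⊆ᴰ-of-T t x< = to (subst T (sym (containedᵇ-cells λ' S)) t) (∈-cells⁺ λ' x<)
  T-of-⊆ᴰ : λ' ⊆ᴰ S → T (Contained λ' S)
  T-of-⊆ᴰ λ'⊆S = subst T (containedᵇ-cells λ' S) (from λ { {x , y} c∈ → λ'⊆S (∈-cells⁻ λ' c∈) })

∈-decSeqs⁻ : ∀ m N {λ'} → λ' ∈ decSeqs m N → length λ' ≡ m × part λ' 0 ≤ N × Decreasing λ'
∈-decSeqs⁻ zero    N (here refl) = refl , z≤n , λ _ → z≤n
∈-decSeqs⁻ (suc m) N λ'∈
  with _ , a∈ , λ'∈′ ← find (∈-concatMap⁻ (λ a → map (a ∷_) (decSeqs m a)) {xs = upTo (suc N)} λ'∈)
  with _ , tail∈ , refl ← ∈-map⁻ _ λ'∈′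
  with len , head≤a , dec ← ∈-decSeqs⁻ m _ tail∈
  = cong suc len , s≤s⁻¹ (∈-upTo⁻ a∈) , ∷-decreasing head≤a dec

∈-decSeqs⁺ : ∀ m N {λ'} → length λ' ≡ m → part λ' 0 ≤ N → Decreasing λ' → λ' ∈ decSeqs m N
∈-decSeqs⁺ zero    N {[]}     _   _   _   = here refl
∈-decSeqs⁺ (suc m) N {a ∷ λ'} len a≤N dec =
  ∈-concatMap⁺ (λ b → map (b ∷_) (decSeqs m b)) {xs = upTo (suc N)}
    (lose (∈-upTo⁺ (s≤s a≤N)) (∈-map⁺ (a ∷_) (∈-decSeqs⁺ m a (suc-injective len) (dec 0) (dec ∘ suc))))

decSeqs-unique : ∀ m N → Unique (decSeqs m N)
decSeqs-unique zero    N = [] ∷ []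
decSeqs-unique (suc m) N = concatMap-unique (λ λ' → part λ' 0) (Unique.upTo⁺ (suc N))
  (λ a → Unique.map⁺ List.∷-injectiveʳ (decSeqs-unique m a)) keyed
  where
  keyed : ∀ {a λ'} → λ' ∈ map (a ∷_) (decSeqs m a) → part λ' 0 ≡ a
  keyed {a} λ'∈ with _ , _ , refl ← ∈-map⁻ (a ∷_) λ'∈ = refl

sum≤length : ∀ {λ' S} → Unique S → λ' ⊆ᴰ S → sumℕ λ' ≤ length S
sum≤length {λ'} {S} S! λ'⊆S = subst (_≤ length S) (length-cells λ')
  (length-mono-⊆ _≟c_ (cells-unique λ') S! λ { {x , y} c∈ → λ'⊆S (∈-cells⁻ λ' c∈) })

record Fits (S : CellSet) (m : ℕ) (λ' : List ℕ) : Set where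
  constructor fits
  field
    length≡    : length λ' ≡ m
    decreasing : Decreasing λ'
    inside     : λ' ⊆ᴰ S

∈-partsIn⁻ : ∀ {S m λ'} → λ' ∈ partsIn S m → Fits S m λ'
∈-partsIn⁻ {S} {m} {λ'} λ'∈
  with λ'∈′ , t ← ∈-filter⁻ (λ μ → T? (Contained μ S)) {xs = decSeqs m (length S)} λ'∈
  with len , _ , dec ← ∈-decSeqs⁻ m (length S) λ'∈′
  = fits len dec (Equivalence.to (T-Contained⇔ λ' S) t)

∈-partsIn⁺ : ∀ {S m λ'} → Unique S → Fits S m λ' → λ' ∈ partsIn S m
∈-partsIn⁺ {S} {m} {λ'} S! (fits len dec λ'⊆S) = ∈-filter⁺ (λ μ → T? (Contained μ S))
  (∈-decSeqs⁺ m (length S) len (≤-trans (part≤sum λ' 0) (sum≤length {λ'} S! λ'⊆S)) dec)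
  (Equivalence.from (T-Contained⇔ λ' S) λ'⊆S)

partsIn-unique : ∀ S m → Unique (partsIn S m)
partsIn-unique S m = Unique.filter⁺ (λ μ → T? (Contained μ S)) (decSeqs-unique m (length S))

multiplicity : List ℕ → ℕ → ℕ
multiplicity λ' x = length (filter (x ≟_) λ')

nonzeros : List ℕ → List ℕ
nonzeros = filter (λ c → ¬? (c ≟ 0))

-- Names the `where` function of `skewCells`, as `containedᵇ` does for `Contained`.
mutual
  skewCellsFrom : List ℕ → ℕ → List ℕ → CellSet
  skewCellsFrom = _

  skewCells-∷ : ∀ a as → skewCells (a ∷ as) ≡ (a , 0) ∷ skewCellsFrom (a ∷ as) 1 as
  skewCells-∷ a as with a ∷ as | 1
  ... | _ | _ = refl

map-proj₁-skewCellsFrom : ∀ λ' r as → map proj₁ (skewCellsFrom λ' r as) ≡ as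
map-proj₁-skewCellsFrom λ' r []       = refl
map-proj₁-skewCellsFrom λ' r (a ∷ as) = cong (a ∷_) (map-proj₁-skewCellsFrom λ' (suc r) as)

map-proj₁-skewCells : ∀ λ' → map proj₁ (skewCells λ') ≡ λ'
map-proj₁-skewCells []       = refl
map-proj₁-skewCells (a ∷ as) =
  trans (cong (map proj₁) (skewCells-∷ a as)) (cong (a ∷_) (map-proj₁-skewCellsFrom (a ∷ as) 1 as))

length-filter-map : ∀ {p q} {B : Set} {P : Pred B p} {Q : Pred A q} (P? : Decidable P) (Q? : Decidable Q)
  (f : A → B) → (∀ {a} → P (f a) ⇔ Q a) → ∀ as → length (filter P? (map f as)) ≡ length (filter Q? as)
length-filter-map P? Q? f P⇔Q []       = refl
length-filter-map P? Q? f P⇔Q (a ∷ as) with P? (f a) | Q? a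
... | yes _  | yes _  = cong suc (length-filter-map P? Q? f P⇔Q as)
... | no  _  | no  _  = length-filter-map P? Q? f P⇔Q as
... | yes pa | no ¬qa = contradiction (Equivalence.to P⇔Q pa) ¬qa
... | no ¬pa | yes qa = contradiction (Equivalence.from P⇔Q qa) ¬pa

columnLengths-multiplicity : ∀ λ' → columnLengths λ' ≡ nonzeros (applyUpTo (multiplicity λ') (suc (sumℕ λ')))
columnLengths-multiplicity λ' = cong nonzeros (trans
  (List.map-cong (λ x → trans (sym (length-filter-map (x ≟_) _ proj₁ (mk⇔ id id) (skewCells λ')))
                              (cong (λ as → multiplicity as x) (map-proj₁-skewCells λ')))
                 (upTo (suc (sumℕ λ'))))
  (List.map-upTo (multiplicity λ') (suc (sumℕ λ'))))

applyUpTo-+ : ∀ (f : ℕ → A) B C → applyUpTo f (B + C) ≡ applyUpTo f B ++ applyUpTo (f ∘ (B +_)) C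
applyUpTo-+ f zero    C = refl
applyUpTo-+ f (suc B) C = cong (f 0 ∷_) (applyUpTo-+ (f ∘ suc) B C)

applyUpTo-cong< : ∀ {f g : ℕ → A} B → (∀ {x} → x < B → f x ≡ g x) → applyUpTo f B ≡ applyUpTo g B
applyUpTo-cong< zero    f≐g = refl
applyUpTo-cong< (suc B) f≐g = cong₂ _∷_ (f≐g (s≤s z≤n)) (applyUpTo-cong< B (f≐g ∘ s≤s))

nonzeros-applyUpTo-+ : ∀ (f : ℕ → ℕ) B C → (∀ x → f (B + x) ≡ 0) →
                       nonzeros (applyUpTo f (B + C)) ≡ nonzeros (applyUpTo f B)
nonzeros-applyUpTo-+ f B C f≡0 = begin
  nonzeros (applyUpTo f (B + C))                                 ≡⟨ cong nonzeros (applyUpTo-+ f B C) ⟩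
  nonzeros (applyUpTo f B ++ applyUpTo (f ∘ (B +_)) C)           ≡⟨ List.filter-++ _ (applyUpTo f B) _ ⟩
  nonzeros (applyUpTo f B) ++ nonzeros (applyUpTo (f ∘ (B +_)) C) ≡⟨ cong (nonzeros (applyUpTo f B) ++_) zeros ⟩
  nonzeros (applyUpTo f B) ++ []                                 ≡⟨ List.++-identityʳ _ ⟩
  nonzeros (applyUpTo f B)                                       ∎
  where
  open ≡-Reasoning
  zeros : nonzeros (applyUpTo (f ∘ (B +_)) C) ≡ []
  zeros = List.filter-none _ (All.applyUpTo⁺₂ _ C λ x ¬f≡0 → ¬f≡0 (f≡0 x))

multiplicity-absent : ∀ {x} as → All (λ a → x ≢ a) as → multiplicity as x ≡ 0
multiplicity-absent as x∉ = cong length (List.filter-none _ x∉)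

multiplicity-++ : ∀ as bs x → multiplicity (as ++ bs) x ≡ multiplicity as x + multiplicity bs x
multiplicity-++ as bs x = trans (cong length (List.filter-++ (x ≟_) as bs)) (List.length-++ (filter (x ≟_) as))

multiplicity-map+ : ∀ k ν x → multiplicity (map (_+ k) ν) (k + x) ≡ multiplicity ν x
multiplicity-map+ k ν x = length-filter-map (k + x ≟_) (x ≟_) (_+ k)
  (mk⇔ (λ k+x≡a+k → +-cancelˡ-≡ k x _ (trans k+x≡a+k (+-comm _ k))) (λ { refl → +-comm k x })) ν

multiplicity-beyond : ∀ {B} as → All (_< B) as → ∀ x → multiplicity as (B + x) ≡ 0
multiplicity-beyond as as<B x =
  multiplicity-absent as (All.map (λ a<B B+x≡a → <⇒≱ a<B (≤-trans (m≤m+n _ x) (≤-reflexive B+x≡a))) as<B)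

entries<suc-sum : ∀ as → All (_< suc (sumℕ as)) as
entries<suc-sum []       = []
entries<suc-sum (a ∷ as) =
  s≤s (m≤m+n a (sumℕ as)) ∷ All.map (λ b< → ≤-trans b< (s≤s (m≤n+m (sumℕ as) a))) (entries<suc-sum as)

columnLengths-bounded : ∀ {B} λ' → All (_< B) λ' → columnLengths λ' ≡ nonzeros (applyUpTo (multiplicity λ') B)
columnLengths-bounded {B} λ' λ'<B = begin
  columnLengths λ'
    ≡⟨ columnLengths-multiplicity λ' ⟩
  nonzeros (applyUpTo (multiplicity λ') M)
    ≡⟨ nonzeros-applyUpTo-+ (multiplicity λ') M B (multiplicity-beyond λ' (entries<suc-sum λ')) ⟨
  nonzeros (applyUpTo (multiplicity λ') (M + B))
    ≡⟨ cong (nonzeros ∘ applyUpTo (multiplicity λ')) (+-comm M B) ⟩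
  nonzeros (applyUpTo (multiplicity λ') (B + M))
    ≡⟨ nonzeros-applyUpTo-+ (multiplicity λ') B M (multiplicity-beyond λ' λ'<B) ⟩
  nonzeros (applyUpTo (multiplicity λ') B) ∎
  where
  open ≡-Reasoning
  M = suc (sumℕ λ')

glue : ℕ → List ℕ → List ℕ → List ℕ
glue k ν μ = map (_+ k) ν ++ μ

columnLengths-glue : ∀ k ν μ → All (_< k) μ → columnLengths (glue k ν μ) ≡ columnLengths μ ++ columnLengths ν
columnLengths-glue k ν μ μ<k = begin
  columnLengths λ'
    ≡⟨ columnLengths-bounded λ' λ'<k+M ⟩
  nonzeros (applyUpTo (multiplicity λ') (k + M))
    ≡⟨ cong nonzeros (applyUpTo-+ (multiplicity λ') k M) ⟩
  nonzeros (applyUpTo (multiplicity λ') k ++ applyUpTo (multiplicity λ' ∘ (k +_)) M)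
    ≡⟨ List.filter-++ _ (applyUpTo (multiplicity λ') k) _ ⟩
  nonzeros (applyUpTo (multiplicity λ') k) ++ nonzeros (applyUpTo (multiplicity λ' ∘ (k +_)) M)
    ≡⟨ cong₂ (λ as bs → nonzeros as ++ nonzeros bs) (applyUpTo-cong< k low) (applyUpTo-cong< M λ {x} _ → high x) ⟩
  nonzeros (applyUpTo (multiplicity μ) k) ++ nonzeros (applyUpTo (multiplicity ν) M)
    ≡⟨ cong₂ _++_ (columnLengths-bounded μ μ<k) (columnLengths-multiplicity ν) ⟨
  columnLengths μ ++ columnLengths ν ∎
  where
  open ≡-Reasoning
  λ' = glue k ν μ
  M = suc (sumℕ ν)
  λ'<k+M : All (_< k + M) λ'
  λ'<k+M = All.++⁺ (All.map⁺ (All.map (λ a< → subst (_< k + M) (+-comm k _) (+-monoʳ-< k a<)) (entries<suc-sum ν)))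
                   (All.map (λ a<k → ≤-trans a<k (m≤m+n k M)) μ<k)
  low : ∀ {x} → x < k → multiplicity λ' x ≡ multiplicity μ x
  low {x} x<k = begin
    multiplicity λ' x                                 ≡⟨ multiplicity-++ (map (_+ k) ν) μ x ⟩
    multiplicity (map (_+ k) ν) x + multiplicity μ x   ≡⟨ cong (_+ multiplicity μ x) (multiplicity-absent (map (_+ k) ν) x∉) ⟩
    multiplicity μ x                                  ∎
    where
    x∉ : All (λ a → x ≢ a) (map (_+ k) ν)
    x∉ = All.map⁺ (All.tabulate λ {a} _ x≡a+k → <⇒≱ x<k (≤-trans (m≤n+m k a) (≤-reflexive (sym x≡a+k))))
  high : ∀ x → multiplicity λ' (k + x) ≡ multiplicity ν x
  high x = begin
    multiplicity λ' (k + x)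
      ≡⟨ multiplicity-++ (map (_+ k) ν) μ (k + x) ⟩
    multiplicity (map (_+ k) ν) (k + x) + multiplicity μ (k + x)
      ≡⟨ cong₂ _+_ (multiplicity-map+ k ν x) (multiplicity-beyond μ μ<k x) ⟩
    multiplicity ν x + 0
      ≡⟨ +-identityʳ _ ⟩
    multiplicity ν x ∎

part-glue-low : ∀ k ν μ {y} → y < length ν → part (glue k ν μ) y ≡ part ν y + k
part-glue-low k (a ∷ ν) μ {zero}  _         = refl
part-glue-low k (a ∷ ν) μ {suc y} (s≤s y<) = part-glue-low k ν μ y<

part-glue-high : ∀ k ν μ y → part (glue k ν μ) (length ν + y) ≡ part μ y
part-glue-high k []      μ y = refl
part-glue-high k (a ∷ ν) μ y = part-glue-high k ν μ y

length-glue : ∀ k ν μ → length (glue k ν μ) ≡ length ν + length μ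
length-glue k ν μ = trans (List.length-++ (map (_+ k) ν)) (cong (_+ length μ) (List.length-map (_+ k) ν))

sum-map-+ : ∀ k ν → sumℕ (map (_+ k) ν) ≡ sumℕ ν + length ν * k
sum-map-+ k []      = refl
sum-map-+ k (a ∷ ν) = begin
  a + k + sumℕ (map (_+ k) ν)       ≡⟨ cong (a + k +_) (sum-map-+ k ν) ⟩
  a + k + (sumℕ ν + length ν * k)   ≡⟨ solve 4 (λ a k s l → a :+ k :+ (s :+ l) := a :+ s :+ (k :+ l))
                                                 refl a k (sumℕ ν) (length ν * k) ⟩
  a + sumℕ ν + (k + length ν * k)   ∎
  where
  open ≡-Reasoning
  open +-*-Solver

sum-glue : ∀ k ν μ → sumℕ (glue k ν μ) ≡ sumℕ ν + length ν * k + sumℕ μ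
sum-glue k ν μ = trans (sum-++ (map (_+ k) ν) μ) (cong (_+ sumℕ μ) (sum-map-+ k ν))

part₀-glue≤ : ∀ {k a} ν μ → part μ 0 ≤ k → part ν 0 ≤ a → part (glue k ν μ) 0 ≤ a + k
part₀-glue≤ {k} {a} []      μ μ₀≤k _   = ≤-trans μ₀≤k (m≤n+m k a)
part₀-glue≤ {k}     (b ∷ ν) μ _    b≤a = +-monoˡ-≤ k b≤a

glue-decreasing : ∀ {k} ν {μ} → Decreasing ν → Decreasing μ → part μ 0 ≤ k → Decreasing (glue k ν μ)
glue-decreasing []          _  dμ _    = dμ
glue-decreasing (a ∷ ν) {μ} dν dμ μ₀≤k =
  ∷-decreasing (part₀-glue≤ ν μ μ₀≤k (dν 0)) (glue-decreasing ν (dν ∘ suc) dμ μ₀≤k)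

glue-decreasing⁻ : ∀ k ν μ → Decreasing (glue k ν μ) → Decreasing ν × Decreasing μ
glue-decreasing⁻ k []      μ d = (λ _ → z≤n) , d
glue-decreasing⁻ k (a ∷ ν) μ d with dν , dμ ← glue-decreasing⁻ k ν μ (d ∘ suc) = ∷-decreasing (head≤ ν (d 0)) dν , dμ
  where
  head≤ : ∀ ν → part (glue k ν μ) 0 ≤ a + k → part ν 0 ≤ a
  head≤ []      _ = z≤n
  head≤ (b ∷ ν) b+k≤a+k = +-cancelʳ-≤ k b a b+k≤a+k

glue-injective : ∀ k {ν ν′ μ μ′} → length ν ≡ length ν′ →
                 glue k ν μ ≡ glue k ν′ μ′ → ν ≡ ν′ × μ ≡ μ′
glue-injective k {[]}    {[]}     _   eq = refl , eq
glue-injective k {a ∷ ν} {a′ ∷ ν′} {μ} {μ′} len eq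
  with a+k≡ , eq′ ← List.∷-injective eq
  with refl , refl ← glue-injective k {ν} {ν′} {μ} {μ′} (suc-injective len) eq′
  = cong (_∷ ν) (+-cancelʳ-≡ k a a′ a+k≡) , refl

glue-split : ∀ k m λ' → (∀ {y} → y < m → k ≤ part λ' y) → glue k (map (_∸ k) (take m λ')) (drop m λ') ≡ λ'
glue-split k zero    λ'       _   = refl
glue-split k (suc m) []       _   = refl
glue-split k (suc m) (a ∷ λ') k≤ = cong₂ _∷_ (m∸n+n≡m (k≤ (s≤s z≤n))) (glue-split k m λ' (k≤ ∘ s≤s))

length-map-take : ∀ k m λ' → m ≤ length λ' → length (map (_∸ k) (take m λ')) ≡ m
length-map-take k m λ' m≤ = trans (List.length-map (_∸ k) (take m λ')) (trans (List.length-take m λ') (m≤n⇒m⊓n≡m m≤))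

decreasing⇒All≤head : ∀ {μ} → Decreasing μ → All (_≤ part μ 0) μ
decreasing⇒All≤head {[]}    _ = []
decreasing⇒All≤head {a ∷ μ} d = ≤-refl ∷ All.map (λ b≤ → ≤-trans b≤ (d 0)) (decreasing⇒All≤head (d ∘ suc))

part-drop : ∀ m as y → part (drop m as) y ≡ part as (y + m)
part-drop zero    as       y = cong (part as) (sym (+-identityʳ y))
part-drop (suc m) []       y = refl
part-drop (suc m) (a ∷ as) y = trans (part-drop m as y) (cong (part (a ∷ as)) (sym (+-suc y m)))

data Position (m : ℕ) : ℕ → Set where
  below : ∀ {y} → y < m → Position m y
  above : ∀ y → Position m (m + y)

position : ∀ m y → Position m y
position zero    y       = above y
position (suc m) zero    = below (s≤s z≤n)
position (suc m) (suc y) with position m y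
... | below y<m = below (s≤s y<m)
... | above y′  = above y′

IsCorner : List ℕ → Cell → Set
IsCorner τ (i , j) = part τ j ≡ suc i × part τ (suc j) ≤ i

diagonal⇒corner : ∀ {τ c} → IsTriangular τ → InDiagonal τ c → IsCorner τ c
diagonal⇒corner {τ} {i , j} τ-triangular c-diagonal =
  ≤-antisym (≮⇒≥ (diagonal-right∉ {τ} τ-triangular c-diagonal ∘ ∈-cells⁺ τ)) (∈-cells⁻ τ (proj₁ c-diagonal)) ,
  ≮⇒≥ (diagonal-up∉ {τ} τ-triangular c-diagonal ∘ ∈-cells⁺ τ)

-- The `+ 0` is the q-exponent of the single monomial of `skewSchur`.
term : CellSet → List ℕ → Mono
term S λ' = ((length S ∸ sumℕ λ') + 0 , columnLengths λ')

𝓔≡map-term : ∀ S m → 𝓔 S m ≡ map (term S) (partsIn S m)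
𝓔≡map-term S m = trans (sym (List.concatMap-map [_] (term S) (partsIn S m))) (List.concatMap-pure (map (term S) (partsIn S m)))

map-cartesianProductWith : ∀ {A B C E : Set} (h : C → E) (f : A → B → C) xs ys →
  map h (cartesianProductWith f xs ys) ≡ cartesianProductWith (λ x y → h (f x y)) xs ys
map-cartesianProductWith h f []       ys = refl
map-cartesianProductWith h f (x ∷ xs) ys =
  trans (List.map-++ h (map (f x) ys) _) (cong₂ _++_ (sym (List.map-∘ ys)) (map-cartesianProductWith h f xs ys))

qpow·-⊗ : ∀ a (f g : List ℕ → Mono) P Q → qpow· a (map f P ⊗ map g Q) ≡
  cartesianProductWith (λ μ ν → (a + (proj₁ (f μ) + proj₁ (g ν)) , proj₂ (f μ) ++ proj₂ (g ν))) P Q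
qpow·-⊗ a f g []      Q = refl
qpow·-⊗ a f g (μ ∷ P) Q = trans (List.map-++ _ (map _ (map g Q)) (map f P ⊗ map g Q))
  (cong₂ _++_ (trans (sym (List.map-∘ (map g Q))) (sym (List.map-∘ Q))) (qpow·-⊗ a f g P Q))

exponent-at-corner : ∀ {a∂ am b c sμ sν} → sμ ≤ am → sν ≤ b →
  (b + c + (a∂ + am)) ∸ (sν + c + sμ) + 0 ≡ a∂ + ((am ∸ sμ) + 0 + ((b ∸ sν) + 0))
exponent-at-corner {a∂} {c = c} {sμ} {sν} sμ≤am sν≤b
  with o , refl ← m≤n⇒∃[o]m+o≡n sμ≤am | o′ , refl ← m≤n⇒∃[o]m+o≡n sν≤b = begin
  (sν + o′ + c + (a∂ + (sμ + o))) ∸ (sν + c + sμ) + 0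
    ≡⟨ cong (λ t → t ∸ (sν + c + sμ) + 0) (solve 6 (λ sν o′ c a∂ sμ o →
         sν :+ o′ :+ c :+ (a∂ :+ (sμ :+ o)) := (a∂ :+ (o :+ con 0 :+ (o′ :+ con 0))) :+ (sν :+ c :+ sμ))
         refl sν o′ c a∂ sμ o) ⟩
  (a∂ + (o + 0 + (o′ + 0))) + (sν + c + sμ) ∸ (sν + c + sμ) + 0
    ≡⟨ trans (+-identityʳ _) (m+n∸n≡m _ (sν + c + sμ)) ⟩
  a∂ + (o + 0 + (o′ + 0))
    ≡⟨ cong₂ (λ x y → a∂ + (x + 0 + (y + 0))) (m+n∸m≡n sμ o) (m+n∸m≡n sν o′) ⟨
  a∂ + ((sμ + o ∸ sμ) + 0 + ((sν + o′ ∸ sν) + 0)) ∎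
  where
  open ≡-Reasoning
  open +-*-Solver

module CornerRecursion
  (τ : List ℕ) (τ-partition : IsPartition τ)
  (D : CellSet) (D-unique : Unique D) (D-corners : ∀ {c} → c ∈ D → IsCorner τ c)
  (n : ℕ) (ℓτ<n : length τ < n)
  where

  N : ℕ
  N = length (cells τ)

  τ-decreasing : Decreasing τ
  τ-decreasing = linked⇒decreasing (proj₁ τ-partition)

  module _ {i j : ℕ} (γ∈D : (i , j) ∈ D) where

    corner-row : part τ j ≡ suc i
    corner-row = proj₁ (D-corners γ∈D)

    corner-above : part τ (suc j) ≤ i
    corner-above = proj₂ (D-corners γ∈D)

    rows-below-corner : ∀ {y} → y ≤ j → suc i ≤ part τ y
    rows-below-corner y≤j = ≤-trans (≤-reflexive (sym corner-row)) (decreasing-antitone {τ} τ-decreasing y≤j)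

    rows-above-corner : ∀ {y} → j < y → part τ y ≤ i
    rows-above-corner j<y = ≤-trans (decreasing-antitone {τ} τ-decreasing j<y) corner-above

    corner-row<length : suc j ≤ length τ
    corner-row<length = part>0⇒<length τ j (subst (0 <_) (sym corner-row) (s≤s z≤n))

    corner-row<n : suc j ≤ n
    corner-row<n = ≤-trans corner-row<length (<⇒≤ ℓτ<n)

  D⊆τ : D ⊆ cells τ
  D⊆τ {i , j} γ∈D = ∈-cells⁺ τ (≤-reflexive (sym (corner-row γ∈D)))

  corners-in-row : ∀ {i i′ j} → (i , j) ∈ D → (i′ , j) ∈ D → i ≡ i′
  corners-in-row γ∈D γ′∈D = suc-injective (trans (sym (corner-row γ∈D)) (corner-row γ′∈D))

  dominated-∈-box : ∀ {x y x′ y′} → (x′ , y′) ∈ cells τ → x ≤ x′ → y ≤ y′ → (x , y) ∈ box N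
  dominated-∈-box c∈ x≤ y≤ with x′<N , y′<N ← cells-bounded τ-partition c∈ =
    ∈-box⁺ (≤-<-trans x≤ x′<N) (≤-<-trans y≤ y′<N)

  ∈-interior⁻ : ∀ {c} → c ∈ interior τ D → c ∈ cells τ × c ∉ D
  ∈-interior⁻ = ∈-filter⁻ _ {xs = cells τ}

  ∈-interior⁺ : ∀ {c} → c ∈ cells τ → c ∉ D → c ∈ interior τ D
  ∈-interior⁺ = ∈-filter⁺ _

  ∈-αset⁻ : ∀ {γ x y} → (x , y) ∈ αset τ γ → (x , y + suc (proj₂ γ)) ∈ cells τ
  ∈-αset⁻ {γ} = proj₂ ∘ ∈-filter⁻ _ {xs = box N}

  ∈-αset⁺ : ∀ {γ x y} → (x , y + suc (proj₂ γ)) ∈ cells τ → (x , y) ∈ αset τ γ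
  ∈-αset⁺ {γ} c∈ = ∈-filter⁺ _ (dominated-∈-box c∈ ≤-refl (m≤m+n _ _)) c∈

  ∈-αminus⁻ : ∀ {γ x y} → (x , y) ∈ αminus τ D γ →
              (x , y + suc (proj₂ γ)) ∈ cells τ × (x , y + suc (proj₂ γ)) ∉ D
  ∈-αminus⁻ {γ} c∈ with c∈α , c∉α∂ ← ∈-filter⁻ _ {xs = αset τ γ} c∈ =
    ∈-αset⁻ {γ} c∈α , λ c∈D → c∉α∂ (∈-filter⁺ _ c∈α c∈D)

  ∈-αminus⁺ : ∀ {γ x y} → (x , y + suc (proj₂ γ)) ∈ cells τ → (x , y + suc (proj₂ γ)) ∉ D →
              (x , y) ∈ αminus τ D γ
  ∈-αminus⁺ {γ} c∈τ c∉D = ∈-filter⁺ _ (∈-αset⁺ {γ} c∈τ) (c∉D ∘ proj₂ ∘ ∈-filter⁻ _ {xs = αset τ γ})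

  ∈-βset⁻ : ∀ {γ x y} → (x , y) ∈ βset τ γ → (x + suc (proj₁ γ) , y) ∈ cells τ
  ∈-βset⁻ {γ} = proj₂ ∘ ∈-filter⁻ _ {xs = box N}

  ∈-βset⁺ : ∀ {γ x y} → (x + suc (proj₁ γ) , y) ∈ cells τ → (x , y) ∈ βset τ γ
  ∈-βset⁺ {γ} c∈ = ∈-filter⁺ _ (dominated-∈-box c∈ (m≤m+n _ _) ≤-refl) c∈

  τ-unique : Unique (cells τ)
  τ-unique = cells-unique τ

  interior-unique : Unique (interior τ D)
  interior-unique = Unique.filter⁺ _ τ-unique

  αset-unique : ∀ γ → Unique (αset τ γ)
  αset-unique γ = Unique.filter⁺ _ (box-unique N)

  α∂set-unique : ∀ γ → Unique (α∂set τ D γ)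
  α∂set-unique γ = Unique.filter⁺ _ (αset-unique γ)

  αminus-unique : ∀ γ → Unique (αminus τ D γ)
  αminus-unique γ = Unique.filter⁺ _ (αset-unique γ)

  βset-unique : ∀ γ → Unique (βset τ γ)
  βset-unique γ = Unique.filter⁺ _ (box-unique N)

  βpartition αpartition : Cell → List ℕ
  βpartition (i , j) = map (_∸ suc i) (take (suc j) τ)
  αpartition (i , j) = drop (suc j) τ

  module _ {i j : ℕ} (γ∈D : (i , j) ∈ D) where

    length-βpartition : length (βpartition (i , j)) ≡ suc j
    length-βpartition = length-map-take (suc i) (suc j) τ (corner-row<length γ∈D)

    τ-split : glue (suc i) (βpartition (i , j)) (αpartition (i , j)) ≡ τ
    τ-split = glue-split (suc i) (suc j) τ (rows-below-corner γ∈D ∘ s≤s⁻¹)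

    part-τ-below : ∀ {y} → y < suc j → part τ y ≡ part (βpartition (i , j)) y + suc i
    part-τ-below {y} y<sj = trans (cong (λ t → part t y) (sym τ-split))
      (part-glue-low (suc i) (βpartition (i , j)) (αpartition (i , j)) (subst (y <_) (sym length-βpartition) y<sj))

    βset-↭ : βset τ (i , j) ↭ cells (βpartition (i , j))
    βset-↭ = unique∧sameMembers⇒↭ (βset-unique (i , j)) (cells-unique (βpartition (i , j))) (mk⇔ to from)
      where
      to : ∀ {c} → c ∈ βset τ (i , j) → c ∈ cells (βpartition (i , j))
      to {x , y} c∈ with y <? suc j | ∈-cells⁻ τ (∈-βset⁻ {i , j} c∈)
      ... | yes y<sj | x+si< =
        ∈-cells⁺ (βpartition (i , j)) (+-cancelʳ-< (suc i) x _ (subst (x + suc i <_) (part-τ-below y<sj) x+si<))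
      ... | no  y≮sj | x+si< =
        contradiction (≤-trans x+si< (rows-above-corner γ∈D (≮⇒≥ y≮sj))) (<⇒≱ (s≤s (≤-trans (n≤1+n i) (m≤n+m (suc i) x))))
      from : ∀ {c} → c ∈ cells (βpartition (i , j)) → c ∈ βset τ (i , j)
      from {x , y} c∈ = ∈-βset⁺ {i , j} (∈-cells⁺ τ (subst (x + suc i <_) (sym (part-τ-below y<sj)) (+-monoˡ-< (suc i) x<)))
        where
        x< = ∈-cells⁻ (βpartition (i , j)) c∈
        y<sj = subst (y <_) length-βpartition (part>0⇒<length (βpartition (i , j)) y (≤-<-trans z≤n x<))

    αset-↭ : αset τ (i , j) ↭ cells (αpartition (i , j))
    αset-↭ = unique∧sameMembers⇒↭ (αset-unique (i , j)) (cells-unique (αpartition (i , j))) (mk⇔ to from)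
      where
      to : ∀ {c} → c ∈ αset τ (i , j) → c ∈ cells (αpartition (i , j))
      to {x , y} c∈ =
        ∈-cells⁺ (αpartition (i , j)) (subst (x <_) (sym (part-drop (suc j) τ y)) (∈-cells⁻ τ (∈-αset⁻ {i , j} c∈)))
      from : ∀ {c} → c ∈ cells (αpartition (i , j)) → c ∈ αset τ (i , j)
      from {x , y} c∈ =
        ∈-αset⁺ {i , j} (∈-cells⁺ τ (subst (x <_) (part-drop (suc j) τ y) (∈-cells⁻ (αpartition (i , j)) c∈)))

    size-at-corner : N ≡ length (βset τ (i , j)) + suc j * suc i + length (αset τ (i , j))
    size-at-corner = begin
      N                                                    ≡⟨ length-cells τ ⟩
      sumℕ τ                                               ≡⟨ cong sumℕ τ-split ⟨
      sumℕ (glue (suc i) β₀ α₀)                            ≡⟨ sum-glue (suc i) β₀ α₀ ⟩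
      sumℕ β₀ + length β₀ * suc i + sumℕ α₀                ≡⟨ cong (λ l → sumℕ β₀ + l * suc i + sumℕ α₀) length-βpartition ⟩
      sumℕ β₀ + suc j * suc i + sumℕ α₀                    ≡⟨ cong₂ (λ b a → b + suc j * suc i + a) |β| |α| ⟨
      length (βset τ (i , j)) + suc j * suc i + length (αset τ (i , j)) ∎
      where
      open ≡-Reasoning
      β₀ = βpartition (i , j)
      α₀ = αpartition (i , j)
      |β| = trans (↭.↭-length βset-↭) (length-cells β₀)
      |α| = trans (↭.↭-length αset-↭) (length-cells α₀)

  length-interior : length D + length (interior τ D) ≡ N
  length-interior = length-⊆+filter-∉ _≟c_ τ-unique D-unique D⊆τ

  length-α∂set+αminus : ∀ γ → length (α∂set τ D γ) + length (αminus τ D γ) ≡ length (αset τ γ)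
  length-α∂set+αminus γ =
    length-⊆+filter-∉ _≟c_ (αset-unique γ) (α∂set-unique γ) (proj₁ ∘ ∈-filter⁻ _ {xs = αset τ γ})

  μ-left-of-corner : ∀ {i j μ} → (i , j) ∈ D → μ ⊆ᴰ αminus τ D (i , j) → part μ 0 ≤ i
  μ-left-of-corner {i} {j} γ∈D μ⊆ = ≮⇒≥ λ i<μ₀ →
    <⇒≱ (∈-cells⁻ τ (proj₁ (∈-αminus⁻ {i , j} (μ⊆ i<μ₀)))) (corner-above γ∈D)

  glue-⊆τ : ∀ {i j μ ν} → (i , j) ∈ D → μ ⊆ᴰ αminus τ D (i , j) → ν ⊆ᴰ βset τ (i , j) → length ν ≡ suc j →
            glue (suc i) ν μ ⊆ᴰ cells τ
  glue-⊆τ {i} {j} {μ} {ν} γ∈D μ⊆ ν⊆ ℓν {x} {y} x< with position (length ν) y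
  ... | above y′ = subst (λ z → (x , z) ∈ cells τ) (trans (+-comm y′ (suc j)) (cong (_+ y′) (sym ℓν)))
                     (proj₁ (∈-αminus⁻ {i , j} (μ⊆ (subst (x <_) (part-glue-high (suc i) ν μ y′) x<))))
  ... | below y<ℓν with x <? suc i
  ...   | yes x<si = ∈-cells⁺ τ (<-≤-trans x<si (rows-below-corner γ∈D (s≤s⁻¹ (subst (y <_) ℓν y<ℓν))))
  ...   | no  x≮si with x′ , refl ← m≤n⇒∃[o]m+o≡n (≮⇒≥ x≮si) =
    subst (λ z → (z , y) ∈ cells τ) (+-comm x′ (suc i)) (∈-βset⁻ {i , j} (ν⊆ x′<))
    where
    x′< : x′ < part ν y
    x′< = +-cancelʳ-< (suc i) x′ (part ν y)
            (subst₂ _<_ (+-comm (suc i) x′) (part-glue-low (suc i) ν μ y<ℓν) x<)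

  corner-in-glue : ∀ {i j ν μ} → length ν ≡ suc j → i < part (glue (suc i) ν μ) j
  corner-in-glue {i} {j} {ν} {μ} ℓν =
    subst (i <_) (sym (part-glue-low (suc i) ν μ (subst (j <_) (sym ℓν) ≤-refl))) (m≤n+m (suc i) (part ν j))

  corners-in-glue-below : ∀ {i j μ ν i′ j′} → μ ⊆ᴰ αminus τ D (i , j) → length ν ≡ suc j →
                          (i′ , j′) ∈ D → i′ < part (glue (suc i) ν μ) j′ → j′ ≤ j
  corners-in-glue-below {i} {j} {μ} {ν} {i′} {j′} μ⊆ ℓν γ′∈D i′< with j′ ≤? j
  ... | yes j′≤j = j′≤j
  ... | no  j′≰j with o , refl ← m≤n⇒∃[o]m+o≡n (≰⇒> j′≰j) =
    contradiction (subst (λ z → (i′ , z) ∈ D) (+-comm (suc j) o) γ′∈D) (proj₂ (∈-αminus⁻ {i , j} (μ⊆ i′<μ)))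
    where
    i′<μ : i′ < part μ o
    i′<μ = subst (i′ <_) (trans (cong (λ l → part (glue (suc i) ν μ) (l + o)) (sym ℓν)) (part-glue-high (suc i) ν μ o)) i′<

  Piece : Set
  Piece = Cell × List ℕ × List ℕ

  Index : Set
  Index = List ℕ ⊎ Piece

  ValidPiece : Piece → Set
  ValidPiece ((i , j) , μ , ν) =
    (i , j) ∈ D × Fits (αminus τ D (i , j)) (n ∸ suc j) μ × Fits (βset τ (i , j)) (suc j) ν

  Valid : Index → Set
  Valid (inj₁ λ') = Fits (interior τ D) n λ'
  Valid (inj₂ p)  = ValidPiece p

  assemble : Index → List ℕ
  assemble (inj₁ λ')                = λ'
  assemble (inj₂ ((i , j) , μ , ν)) = glue (suc i) ν μ

  assemble-fits : ∀ {b} → Valid b → Fits (cells τ) n (assemble b)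
  assemble-fits {inj₁ λ'} (fits ℓλ dλ λ⊆) = fits ℓλ dλ (proj₁ ∘ ∈-interior⁻ ∘ λ⊆)
  assemble-fits {inj₂ ((i , j) , μ , ν)} (γ∈D , fits ℓμ dμ μ⊆ , fits ℓν dν ν⊆) =
    fits ℓglue (glue-decreasing ν {μ} dν dμ (≤-trans (μ-left-of-corner {μ = μ} γ∈D μ⊆) (n≤1+n i)))
               (glue-⊆τ {μ = μ} {ν} γ∈D μ⊆ ν⊆ ℓν)
    where
    ℓglue : length (glue (suc i) ν μ) ≡ n
    ℓglue = trans (length-glue (suc i) ν μ) (trans (cong₂ _+_ ℓν ℓμ) (m+[n∸m]≡n (corner-row<n γ∈D)))

  split-at-highest-corner : ∀ {λ' i j} → Fits (cells τ) n λ' → (i , j) ∈ D → i < part λ' j →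
    (∀ {i′ j′} → (i′ , j′) ∈ D → i′ < part λ' j′ → j′ ≤ j) →
    ∃₂ λ μ ν → ValidPiece ((i , j) , μ , ν) × glue (suc i) ν μ ≡ λ'
  split-at-highest-corner {λ'} {i} {j} (fits ℓλ dλ λ⊆) γ∈D i<λj highest =
    μ , ν , (γ∈D , fits ℓμ dμ μ⊆ , fits ℓν dν ν⊆) , glued
    where
    μ = drop (suc j) λ'
    ν = map (_∸ suc i) (take (suc j) λ')
    glued : glue (suc i) ν μ ≡ λ'
    glued = glue-split (suc i) (suc j) λ' λ y<sj → ≤-trans i<λj (decreasing-antitone {λ'} dλ (s≤s⁻¹ y<sj))
    ℓν : length ν ≡ suc j
    ℓν = length-map-take (suc i) (suc j) λ' (subst (suc j ≤_) (sym ℓλ) (corner-row<n γ∈D))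
    ℓμ : length μ ≡ n ∸ suc j
    ℓμ = trans (List.length-drop (suc j) λ') (cong (_∸ suc j) ℓλ)
    dν = proj₁ (glue-decreasing⁻ (suc i) ν μ (subst Decreasing (sym glued) dλ))
    dμ = proj₂ (glue-decreasing⁻ (suc i) ν μ (subst Decreasing (sym glued) dλ))
    μ⊆ : μ ⊆ᴰ αminus τ D (i , j)
    μ⊆ {x} {y} x< = ∈-αminus⁺ {i , j} (λ⊆ x<λ)
      λ c∈D → <⇒≱ (s≤s (m≤n+m j y)) (subst (_≤ j) (+-suc y j) (highest c∈D x<λ))
      where
      x<λ : x < part λ' (y + suc j)
      x<λ = subst (x <_) (part-drop (suc j) λ' y) x<
    ν⊆ : ν ⊆ᴰ βset τ (i , j)
    ν⊆ {x} {y} x< = ∈-βset⁺ {i , j} (λ⊆ (subst (x + suc i <_) λy≡ (+-monoˡ-< (suc i) x<)))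
      where
      λy≡ : part ν y + suc i ≡ part λ' y
      λy≡ = trans (sym (part-glue-low (suc i) ν μ (part>0⇒<length ν y (≤-<-trans z≤n x<)))) (cong (λ t → part t y) glued)

  assemble-onto : ∀ {λ'} → Fits (cells τ) n λ' → ∃ λ b → Valid b × assemble b ≡ λ'
  assemble-onto {λ'} λ'-fits@(fits ℓλ dλ λ⊆) with any? (λ γ → proj₁ γ <? part λ' (proj₂ γ)) D
  ... | no no-corner = inj₁ λ' , fits ℓλ dλ (λ x< → ∈-interior⁺ (λ⊆ x<) (λ c∈D → no-corner (lose c∈D x<))) , refl
  ... | yes some-corner with maximal-satisfying proj₂ (λ γ → proj₁ γ <? part λ' (proj₂ γ)) some-corner
  ...   | (i , j) , γ∈D , i<λj , highest with μ , ν , valid , glued ← split-at-highest-corner λ'-fits γ∈D i<λj highest =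
    inj₂ ((i , j) , μ , ν) , valid , glued

  assemble-injective : ∀ {b b′} → Valid b → Valid b′ → assemble b ≡ assemble b′ → b ≡ b′
  assemble-injective {inj₁ _} {inj₁ _} _ _ eq = cong inj₁ eq
  assemble-injective {inj₁ _} {inj₂ ((i , j) , μ , ν)} (fits _ _ λ⊆) (γ∈D , _ , fits ℓν _ _) refl =
    contradiction γ∈D (proj₂ (∈-interior⁻ (λ⊆ (corner-in-glue {i} {j} {ν} {μ} ℓν))))
  assemble-injective {inj₂ ((i , j) , μ , ν)} {inj₁ _} (γ∈D , _ , fits ℓν _ _) (fits _ _ λ⊆) refl =
    contradiction γ∈D (proj₂ (∈-interior⁻ (λ⊆ (corner-in-glue {i} {j} {ν} {μ} ℓν))))
  assemble-injective {inj₂ ((i , j) , μ , ν)} {inj₂ ((i′ , j′) , μ′ , ν′)}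
                     (γ∈D , fits _ _ μ⊆ , fits ℓν _ _) (γ′∈D , fits _ _ μ′⊆ , fits ℓν′ _ _) eq
    with refl ← ≤-antisym
      (corners-in-glue-below {μ = μ′} {ν′} μ′⊆ ℓν′ γ∈D (subst (λ t → i < part t j) eq (corner-in-glue {i} {j} {ν} {μ} ℓν)))
      (corners-in-glue-below {μ = μ} {ν} μ⊆ ℓν γ′∈D
        (subst (λ t → i′ < part t j′) (sym eq) (corner-in-glue {i′} {j′} {ν′} {μ′} ℓν′)))
    with refl ← corners-in-row γ∈D γ′∈D
    with refl , refl ← glue-injective (suc i) {ν} {ν′} {μ} {μ′} (trans ℓν (sym ℓν′)) eq
    = refl

  Pint : List (List ℕ)
  Pint = partsIn (interior τ D) n

  Pα Pβ : Cell → List (List ℕ)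
  Pα (i , j) = partsIn (αminus τ D (i , j)) (n ∸ suc j)
  Pβ (i , j) = partsIn (βset τ (i , j)) (suc j)

  pieces : Cell → List Piece
  pieces γ = cartesianProductWith (λ μ ν → (γ , μ , ν)) (Pα γ) (Pβ γ)

  indices : List Index
  indices = map inj₁ Pint ++ map inj₂ (concatMap pieces D)

  ∈-indices⁻ : ∀ {b} → b ∈ indices → Valid b
  ∈-indices⁻ b∈ with ∈-++⁻ (map inj₁ Pint) b∈
  ... | inj₁ b∈₁ with _ , λ∈ , refl ← ∈-map⁻ inj₁ b∈₁ = ∈-partsIn⁻ λ∈
  ... | inj₂ b∈₂
    with _ , p∈ , refl ← ∈-map⁻ inj₂ b∈₂
    with (i , j) , γ∈D , p∈γ ← find (∈-concatMap⁻ pieces {xs = D} p∈)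
    with _ , _ , μ∈ , ν∈ , refl ← ∈-cartesianProductWith⁻ (λ μ ν → ((i , j) , μ , ν)) (Pα (i , j)) (Pβ (i , j)) p∈γ
    = γ∈D , ∈-partsIn⁻ μ∈ , ∈-partsIn⁻ ν∈

  ∈-indices⁺ : ∀ {b} → Valid b → b ∈ indices
  ∈-indices⁺ {inj₁ λ'} λ-fits = ∈-++⁺ˡ (∈-map⁺ inj₁ (∈-partsIn⁺ interior-unique λ-fits))
  ∈-indices⁺ {inj₂ ((i , j) , μ , ν)} (γ∈D , μ-fits , ν-fits) = ∈-++⁺ʳ (map inj₁ Pint) (∈-map⁺ inj₂
    (∈-concatMap⁺ pieces {xs = D} (lose γ∈D (∈-cartesianProductWith⁺ (λ μ ν → ((i , j) , μ , ν))
      (∈-partsIn⁺ (αminus-unique (i , j)) μ-fits) (∈-partsIn⁺ (βset-unique (i , j)) ν-fits)))))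

  indices-unique : Unique indices
  indices-unique = Unique.++⁺ (Unique.map⁺ inj₁-injective (partsIn-unique _ n))
    (Unique.map⁺ inj₂-injective (concatMap-unique proj₁ D-unique pieces-unique keyed)) disjoint
    where
    inj₁-injective : ∀ {a b : List ℕ} → inj₁ {B = Piece} a ≡ inj₁ b → a ≡ b
    inj₁-injective refl = refl
    inj₂-injective : ∀ {p q : Piece} → inj₂ {A = List ℕ} p ≡ inj₂ q → p ≡ q
    inj₂-injective refl = refl
    pieces-unique : ∀ γ → Unique (pieces γ)
    pieces-unique γ@(i , j) = Unique.cartesianProductWith⁺ _ (λ { refl → refl , refl })
      (partsIn-unique (αminus τ D γ) (n ∸ suc j)) (partsIn-unique (βset τ γ) (suc j))
    keyed : ∀ {γ p} → p ∈ pieces γ → proj₁ p ≡ γ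
    keyed {γ} p∈ with _ , _ , _ , _ , refl ← ∈-cartesianProductWith⁻ (λ μ ν → (γ , μ , ν)) (Pα γ) (Pβ γ) p∈ = refl
    disjoint : ∀ {b} → ¬ (b ∈ map inj₁ Pint × b ∈ map inj₂ (concatMap pieces D))
    disjoint (b∈₁ , b∈₂) with _ , _ , refl ← ∈-map⁻ inj₁ b∈₁ with _ , _ , () ← ∈-map⁻ inj₂ b∈₂

  assemble-↭ : map assemble indices ↭ partsIn (cells τ) n
  assemble-↭ = map-↭-bijectiveOn assemble indices-unique (partsIn-unique (cells τ) n)
    (λ b∈ b′∈ → assemble-injective (∈-indices⁻ b∈) (∈-indices⁻ b′∈))
    (∈-partsIn⁺ τ-unique ∘ assemble-fits ∘ ∈-indices⁻)
    (λ λ∈ → let b , valid , assembled = assemble-onto (∈-partsIn⁻ λ∈) in b , ∈-indices⁺ valid , assembled)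

  weightPiece : Piece → Mono
  weightPiece ((i , j) , μ , ν) =
    ( length (α∂set τ D (i , j)) + ((length (αminus τ D (i , j)) ∸ sumℕ μ) + 0 + ((length (βset τ (i , j)) ∸ sumℕ ν) + 0))
    , columnLengths μ ++ columnLengths ν )

  weight : Index → Mono
  weight (inj₁ λ') = (length D + ((length (interior τ D) ∸ sumℕ λ') + 0) , columnLengths λ')
  weight (inj₂ p)  = weightPiece p

  term-assemble : ∀ {b} → Valid b → term (cells τ) (assemble b) ≡ weight b
  term-assemble {inj₁ λ'} (fits _ _ λ⊆) = cong (_, columnLengths λ') (begin
    (N ∸ sumℕ λ') + 0                                  ≡⟨ cong (λ m → (m ∸ sumℕ λ') + 0) length-interior ⟨
    (length D + length (interior τ D) ∸ sumℕ λ') + 0   ≡⟨ cong (_+ 0) (+-∸-assoc (length D) Σλ≤) ⟩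
    (length D + (length (interior τ D) ∸ sumℕ λ')) + 0 ≡⟨ +-assoc (length D) _ 0 ⟩
    length D + ((length (interior τ D) ∸ sumℕ λ') + 0) ∎)
    where
    open ≡-Reasoning
    Σλ≤ = sum≤length {λ'} interior-unique λ⊆
  term-assemble {inj₂ ((i , j) , μ , ν)} (γ∈D , fits _ dμ μ⊆ , fits ℓν _ ν⊆) = cong₂ _,_ (begin
    (N ∸ sumℕ (glue (suc i) ν μ)) + 0
      ≡⟨ cong₂ (λ m s → (m ∸ s) + 0) N≡ Σglue≡ ⟩
    (|β| + suc j * suc i + (length (α∂set τ D (i , j)) + length (αminus τ D (i , j))))
      ∸ (sumℕ ν + suc j * suc i + sumℕ μ) + 0
      ≡⟨ exponent-at-corner (sum≤length {μ} (αminus-unique (i , j)) μ⊆) (sum≤length {ν} (βset-unique (i , j)) ν⊆) ⟩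
    proj₁ (weightPiece ((i , j) , μ , ν)) ∎)
    (columnLengths-glue (suc i) ν μ μ<si)
    where
    open ≡-Reasoning
    |β| = length (βset τ (i , j))
    N≡ = trans (size-at-corner γ∈D) (cong (|β| + suc j * suc i +_) (sym (length-α∂set+αminus (i , j))))
    Σglue≡ = trans (sum-glue (suc i) ν μ) (cong (λ l → sumℕ ν + l * suc i + sumℕ μ) ℓν)
    μ<si : All (_< suc i) μ
    μ<si = All.map (λ a≤μ₀ → s≤s (≤-trans a≤μ₀ (μ-left-of-corner {μ = μ} γ∈D μ⊆))) (decreasing⇒All≤head dμ)

  summand≡map-weightPiece : ∀ γ → summand τ n D γ ≡ map weightPiece (pieces γ)
  summand≡map-weightPiece γ@(i , j) = begin
    qpow· a∂ (𝓔 (αminus τ D γ) (n ∸ suc j) ⊗ 𝓔 (βset τ γ) (suc j))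
      ≡⟨ cong₂ (λ P Q → qpow· a∂ (P ⊗ Q)) (𝓔≡map-term (αminus τ D γ) (n ∸ suc j))
                                           (𝓔≡map-term (βset τ γ) (suc j)) ⟩
    qpow· a∂ (map (term (αminus τ D γ)) (Pα γ) ⊗ map (term (βset τ γ)) (Pβ γ))
      ≡⟨ qpow·-⊗ a∂ (term (αminus τ D γ)) (term (βset τ γ)) (Pα γ) (Pβ γ) ⟩
    cartesianProductWith (λ μ ν → weightPiece (γ , μ , ν)) (Pα γ) (Pβ γ)
      ≡⟨ map-cartesianProductWith weightPiece (λ μ ν → (γ , μ , ν)) (Pα γ) (Pβ γ) ⟨
    map weightPiece (pieces γ) ∎
    where
    open ≡-Reasoning
    a∂ = length (α∂set τ D γ)

  right-hand-side≡map-weight :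
    qpow· (length D) (𝓔 (interior τ D) n) ⊕ Σsym D (summand τ n D) ≡ map weight indices
  right-hand-side≡map-weight = begin
    qpow· (length D) (𝓔 (interior τ D) n) ++ concatMap (summand τ n D) D
      ≡⟨ cong₂ _++_ interior-terms corner-terms ⟩
    map weight (map inj₁ Pint) ++ map weight (map inj₂ (concatMap pieces D))
      ≡⟨ List.map-++ weight (map inj₁ Pint) _ ⟨
    map weight indices ∎
    where
    open ≡-Reasoning
    interior-terms : qpow· (length D) (𝓔 (interior τ D) n) ≡ map weight (map inj₁ Pint)
    interior-terms = trans (cong (qpow· (length D)) (𝓔≡map-term (interior τ D) n))
                           (trans (sym (List.map-∘ Pint)) (List.map-∘ Pint))
    corner-terms : concatMap (summand τ n D) D ≡ map weight (map inj₂ (concatMap pieces D))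
    corner-terms = trans (List.concatMap-cong summand≡map-weightPiece D)
                         (trans (sym (List.map-concatMap weightPiece pieces D)) (List.map-∘ (concatMap pieces D)))

  𝓔-corner-recursion : 𝓔 (cells τ) n ≈Sym (qpow· (length D) (𝓔 (interior τ D) n) ⊕ Σsym D (summand τ n D))
  𝓔-corner-recursion = begin
    𝓔 (cells τ) n                                ≡⟨ 𝓔≡map-term (cells τ) n ⟩
    map (term (cells τ)) (partsIn (cells τ) n)    ≈⟨ ↭⇒↭ₛ′ (Setoid.isEquivalence Mono-setoid)
                                                         (↭.map⁺ (term (cells τ)) (↭-sym assemble-↭)) ⟩
    map (term (cells τ)) (map assemble indices)   ≡⟨ List.map-∘ indices ⟨
    map (term (cells τ) ∘ assemble) indices       ≡⟨ List.map-cong-local (All.tabulate (term-assemble ∘ ∈-indices⁻)) ⟩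
    map weight indices                            ≡⟨ right-hand-side≡map-weight ⟨
    qpow· (length D) (𝓔 (interior τ D) n) ⊕ Σsym D (summand τ n D) ∎
    where
    Mono-setoid = ×-setoid (setoid ℕ) (↭-setoid {A = ℕ})
    open SetoidReasoning PermMono.↭-setoid

mainTheorem15 :
    (τ : List ℕ) → IsPartition τ → IsTriangular τ →
    (D : CellSet) → IsDiagonal τ D →
    (n : ℕ) → length τ < n →
    𝓔 (cells τ) n ≈Sym
      (qpow· (length D) (𝓔 (interior τ D) n) ⊕ Σsym D (summand τ n D))
mainTheorem15 τ τ-partition τ-triangular D (D-unique , D-diagonal) n ℓτ<n =
  CornerRecursion.𝓔-corner-recursion τ τ-partition D D-unique
    (λ {c} c∈D → diagonal⇒corner {τ} τ-triangular (Equivalence.to (D-diagonal c) c∈D)) n ℓτ<n
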